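{- Let $S^p_{n,m}$ denote the $(n,m)$-th entry of the $p$-th power of the infinite lower triangular matrix $\mathcal{S}=(S_{n,m})_{n,m\ge0}$ of Stirling numbers of the second kind ($\mathcal{S}^0$ = identity). For $p\ge1$ define the higher order Fubini numbers $F^p_n=\sum_{m=0}^n S^p_{n,m}\,m!$. Define power series $\sigma^0(t)=t$, $\sigma^1(t)=e^t-1$, $\sigma^p(t)=\sigma^{p-1}(e^t-1)$ for $p>1$, and the higher order Bell polynomials $B^p_n(x)$ ($p\ge0$) by $\sum_{n\ge0}B^p_n(x)\frac{t^n}{n!}=e^{x\sigma^p(t)}$. Then for every $p\ge1$ and $n\ge0$, \[F^p_n=\sum_{k=0}^\infty\frac{B^{p-1}_n(k)}{2^{k+1}}.\]
   Context: $S_{n,m}$ is the number of partitions of an $n$-set into $m$ nonempty blocks. $B^0_n(x)=x^n$, and for $p=1$, $F^1_n$ is the classical Fubini (ordered Bell) number. -}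

module Defs where

open import Data.Nat using (ℕ; zero; suc; _∸_; _≟_; _!)
  renaming (_+_ to _+ℕ_; _*_ to _*ℕ_; _≤_ to _≤ℕ_)
open import Data.Nat.Properties using (_!≢0)

open import Data.Integer using (+_)
open import Data.Rational using (ℚ; 0ℚ; 1ℚ; _+_; _*_; _/_)
open import Relation.Nullary using (yes; no)

S : ℕ → ℕ → ℕ
S zero    zero    = 1
S zero    (suc m) = 0
S (suc n) zero    = 0
S (suc n) (suc m) = suc m *ℕ S n (suc m) +ℕ S n m

sumℕ : ℕ → (ℕ → ℕ) → ℕ
sumℕ zero    f = f 0
sumℕ (suc n) f = sumℕ n f +ℕ f (suc n)

-- The matrix product
-- (𝒮^p 𝒮)_{n,m} = Σ_{j≥0} (𝒮^p)_{n,j} S(j,m); terms with j > n vanish by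
-- lower triangularity, so the sum is taken over j = 0..n.
Spow : ℕ → ℕ → ℕ → ℕ
Spow zero    n m with n ≟ m
... | yes _ = 1
... | no  _ = 0
Spow (suc p) n m = sumℕ n (λ j → Spow p n j *ℕ S j m)

Fubini : ℕ → ℕ → ℕ
Fubini p n = sumℕ n (λ m → Spow p n m *ℕ (m !))

PS : Set
PS = ℕ → ℚ

sumℚ : ℕ → (ℕ → ℚ) → ℚ
sumℚ zero    f = f 0
sumℚ (suc n) f = sumℚ n f + f (suc n)

ℕtoℚ : ℕ → ℚ
ℕtoℚ n = + n / 1

invFact : ℕ → ℚ
invFact k = _/_ (+ 1) (k !) {{k !≢0}}

powℚ : ℚ → ℕ → ℚ
powℚ x zero    = 1ℚ
powℚ x (suc k) = x * powℚ x k

oneS : PS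
oneS zero    = 1ℚ
oneS (suc n) = 0ℚ

mulS : PS → PS → PS
mulS f g n = sumℚ n (λ i → f i * g (n ∸ i))

powS : PS → ℕ → PS
powS g zero    = oneS
powS g (suc k) = mulS g (powS g k)

-- composition f(g(t)) for g with zero constant term:
-- [tⁿ] f(g(t)) = Σ_{k=0}^{n} f_k [tⁿ] g(t)^k
compS : PS → PS → PS
compS f g n = sumℚ n (λ k → f k * powS g k n)

tS : PS
tS zero          = 0ℚ
tS (suc zero)    = 1ℚ
tS (suc (suc n)) = 0ℚ

expm1S : PS
expm1S zero    = 0ℚ
expm1S (suc n) = invFact (suc n)

expxS : ℚ → PS
expxS x k = powℚ x k * invFact k

sigma : ℕ → PS
sigma zero    = tS
sigma (suc p) = compS (sigma p) expm1S

Bell : ℕ → ℕ → ℚ → ℚ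
Bell p n x = ℕtoℚ (n !) * compS (expxS x) (sigma p) n

invPow2 : ℕ → ℚ
invPow2 k = powℚ (+ 1 / 2) (suc k)

partial : (ℕ → ℚ) → ℕ → ℚ
partial a M = sumℚ M a

-- Composing exponential generating functions gives n! [tⁿ] σ^q(t)ᵏ = k! S^q(n,k), by induction on q
-- from n! [tⁿ] (eᵗ - 1)ʲ = j! S(n,j) and the fact that 𝒮 commutes with its powers; hence
-- B^q_n(x) = Σₘ S^q(n,m) xᵐ. At x = k, expanding kᵐ = Σⱼ S(m,j) j! C(k,j) and using
-- Σₖ C(k,j) 2^-(k+1) = 1 collapses the series to Σₘ Σⱼ S^q(n,m) S(m,j) j! = F^{q+1}_n.
-- The partial sum up to k = M falls short of this by a nonnegative remainder in which each
-- weight S^q(n,m) S(m,j) j! is multiplied by 2^-(M+1) Σ_{i≤j} C(M+1,i) ≤ (n+1)² / (M+1-n).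

module Submission where

open import Defs
open import Data.Nat as ℕ using (ℕ; zero; suc; _∸_; z≤n; s≤s; _!; _≤′_; ≤′-refl; ≤′-step)
  renaming (_+_ to _+ℕ_; _*_ to _*ℕ_; _≤_ to _≤ℕ_; _<_ to _<ℕ_; _^_ to _^ℕ_)
import Data.Nat.Properties as ℕP
import Data.Nat.Tactic.RingSolver as NS
import Data.Nat.Coprimality as C
open import Data.Nat.Combinatorics using (_C_; nCk+nC[k+1]≡[n+1]C[k+1]; nCk≡n!/k![n-k]!; k![n∸k]!∣n!; nC1≡n; nCn≡1; k>n⇒nCk≡0)
open import Data.Nat.DivMod using (m/n*n≡m)
import Data.Integer as ℤ
import Data.Integer.Properties as ℤP
open import Data.Product using (∃; Σ; _,_)
open import Data.Rational using (ℚ; 0ℚ; 1ℚ; _+_; _*_; _-_; -_; _<_; _≤_; ∣_∣; _/_; mkℚ; *≤*; *<*; NonNegative; nonNegative)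
open import Data.Rational.Properties
open import Data.Empty using (⊥-elim)
open import Algebra.Properties.Group +-0-group using () renaming (∙-cancelʳ to +-cancelʳ)
open import Relation.Binary.PropositionalEquality
open import Relation.Nullary using (yes; no)
open import Relation.Nullary.Decidable using (dec⇒maybe)
open import Tactic.RingSolver using (solve-∀)
open import Tactic.RingSolver.Core.AlmostCommutativeRing using (AlmostCommutativeRing; fromCommutativeRing)
open ≡-Reasoning

ℚ-ring : AlmostCommutativeRing _ _
ℚ-ring = fromCommutativeRing +-*-commutativeRing (λ x → dec⇒maybe (0ℚ ≟ x))

-- Finite sums and the Kronecker delta

sumℚ-cong : ∀ N {f g : ℕ → ℚ} → (∀ i → i ≤ℕ N → f i ≡ g i) → sumℚ N f ≡ sumℚ N g
sumℚ-cong zero    f≡g = f≡g 0 z≤n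
sumℚ-cong (suc N) f≡g = cong₂ _+_ (sumℚ-cong N (λ i i≤N → f≡g i (ℕP.m≤n⇒m≤1+n i≤N))) (f≡g (suc N) ℕP.≤-refl)

sumℚ-zero : ∀ N {f : ℕ → ℚ} → (∀ i → i ≤ℕ N → f i ≡ 0ℚ) → sumℚ N f ≡ 0ℚ
sumℚ-zero N {f} f≡0 = trans (sumℚ-cong N f≡0) (constant N)
  where
  constant : ∀ N → sumℚ N (λ _ → 0ℚ) ≡ 0ℚ
  constant zero    = refl
  constant (suc N) = cong (_+ 0ℚ) (constant N)

sumℚ-distrib-+ : ∀ N (f g : ℕ → ℚ) → sumℚ N (λ i → f i + g i) ≡ sumℚ N f + sumℚ N g
sumℚ-distrib-+ zero    f g = refl
sumℚ-distrib-+ (suc N) f g = trans (cong (_+ (f (suc N) + g (suc N))) (sumℚ-distrib-+ N f g))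
  (interchange (sumℚ N f) (sumℚ N g) (f (suc N)) (g (suc N)))
  where
  interchange : ∀ a b c d → (a + b) + (c + d) ≡ (a + c) + (b + d)
  interchange = solve-∀ ℚ-ring

sumℚ-distrib-minus : ∀ N (f g : ℕ → ℚ) → sumℚ N (λ i → f i - g i) ≡ sumℚ N f - sumℚ N g
sumℚ-distrib-minus zero    f g = refl
sumℚ-distrib-minus (suc N) f g = trans (cong (_+ (f (suc N) - g (suc N))) (sumℚ-distrib-minus N f g))
  (interchange (sumℚ N f) (sumℚ N g) (f (suc N)) (g (suc N)))
  where
  interchange : ∀ a b c d → (a - b) + (c - d) ≡ (a + c) - (b + d)
  interchange = solve-∀ ℚ-ring

*-distribˡ-sumℚ : ∀ N c (f : ℕ → ℚ) → c * sumℚ N f ≡ sumℚ N (λ i → c * f i)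
*-distribˡ-sumℚ zero    c f = refl
*-distribˡ-sumℚ (suc N) c f =
  trans (*-distribˡ-+ c (sumℚ N f) (f (suc N))) (cong (_+ c * f (suc N)) (*-distribˡ-sumℚ N c f))

*-distribʳ-sumℚ : ∀ N c (f : ℕ → ℚ) → sumℚ N f * c ≡ sumℚ N (λ i → f i * c)
*-distribʳ-sumℚ N c f = trans (*-comm (sumℚ N f) c)
  (trans (*-distribˡ-sumℚ N c f) (sumℚ-cong N (λ i _ → *-comm c (f i))))

sumℚ-swap : ∀ N M (f : ℕ → ℕ → ℚ) →
  sumℚ N (λ i → sumℚ M (f i)) ≡ sumℚ M (λ j → sumℚ N (λ i → f i j))
sumℚ-swap zero    M f = refl
sumℚ-swap (suc N) M f = trans (cong (_+ sumℚ M (f (suc N))) (sumℚ-swap N M f))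
  (sym (sumℚ-distrib-+ M (λ j → sumℚ N (λ i → f i j)) (f (suc N))))

sumℚ-head : ∀ n (f : ℕ → ℚ) → sumℚ (suc n) f ≡ f 0 + sumℚ n (λ i → f (suc i))
sumℚ-head zero    f = refl
sumℚ-head (suc n) f = trans (cong (_+ f (suc (suc n))) (sumℚ-head n f)) (+-assoc (f 0) _ _)

sumℚ-shift : ∀ m (g : ℕ → ℚ) → g 0 ≡ 0ℚ → g (suc m) ≡ 0ℚ → sumℚ m g ≡ sumℚ m (λ j → g (suc j))
sumℚ-shift m g g0≡0 gm+1≡0 = begin
  sumℚ m g                          ≡⟨ sym (trans (cong (sumℚ m g +_) gm+1≡0) (+-identityʳ _)) ⟩
  sumℚ (suc m) g                    ≡⟨ sumℚ-head m g ⟩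
  g 0 + sumℚ m (λ j → g (suc j))    ≡⟨ trans (cong (_+ sumℚ m (λ j → g (suc j))) g0≡0) (+-identityˡ _) ⟩
  sumℚ m (λ j → g (suc j))          ∎

sumℚ-extend : ∀ {n N} {f : ℕ → ℚ} → n ≤ℕ N → (∀ i → n <ℕ i → i ≤ℕ N → f i ≡ 0ℚ) → sumℚ N f ≡ sumℚ n f
sumℚ-extend {n} {N} {f} n≤N f≡0 = go (ℕP.≤⇒≤′ n≤N) f≡0
  where
  go : ∀ {N} → n ≤′ N → (∀ i → n <ℕ i → i ≤ℕ N → f i ≡ 0ℚ) → sumℚ N f ≡ sumℚ n f
  go ≤′-refl         _   = refl
  go (≤′-step n≤′N) f≡0 = trans
    (cong₂ _+_ (go n≤′N (λ i n<i i≤N → f≡0 i n<i (ℕP.m≤n⇒m≤1+n i≤N)))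
               (f≡0 _ (s≤s (ℕP.≤′⇒≤ n≤′N)) ℕP.≤-refl))
    (+-identityʳ (sumℚ n f))

*-nonNeg : ∀ {a b} → 0ℚ ≤ a → 0ℚ ≤ b → 0ℚ ≤ a * b
*-nonNeg {a} {b} 0≤a 0≤b = subst (_≤ a * b) (*-zeroʳ a) (*-monoˡ-≤-nonNeg a {{nonNegative 0≤a}} 0≤b)

sumℚ-mono-≤ : ∀ N {f g : ℕ → ℚ} → (∀ i → i ≤ℕ N → f i ≤ g i) → sumℚ N f ≤ sumℚ N g
sumℚ-mono-≤ zero    f≤g = f≤g 0 z≤n
sumℚ-mono-≤ (suc N) f≤g = +-mono-≤ (sumℚ-mono-≤ N (λ i i≤N → f≤g i (ℕP.m≤n⇒m≤1+n i≤N))) (f≤g (suc N) ℕP.≤-refl)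

sumℚ-nonNeg : ∀ N {f : ℕ → ℚ} → (∀ i → i ≤ℕ N → 0ℚ ≤ f i) → 0ℚ ≤ sumℚ N f
sumℚ-nonNeg N {f} 0≤f = subst (_≤ sumℚ N f) (sumℚ-zero N {λ _ → 0ℚ} (λ _ _ → refl)) (sumℚ-mono-≤ N 0≤f)

sumℚ² : ℕ → (ℕ → ℕ → ℚ) → ℚ
sumℚ² N F = sumℚ N (λ i → sumℚ N (F i))

sumℚ²-cong : ∀ N {F G : ℕ → ℕ → ℚ} → (∀ i j → i ≤ℕ N → j ≤ℕ N → F i j ≡ G i j) → sumℚ² N F ≡ sumℚ² N G
sumℚ²-cong N F≡G = sumℚ-cong N (λ i i≤N → sumℚ-cong N (λ j j≤N → F≡G i j i≤N j≤N))

*-distribˡ-sumℚ² : ∀ N c (F : ℕ → ℕ → ℚ) → c * sumℚ² N F ≡ sumℚ² N (λ i j → c * F i j)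
*-distribˡ-sumℚ² N c F = trans (*-distribˡ-sumℚ N c _) (sumℚ-cong N (λ i _ → *-distribˡ-sumℚ N c (F i)))

*-distribʳ-sumℚ² : ∀ N c (F : ℕ → ℕ → ℚ) → sumℚ² N F * c ≡ sumℚ² N (λ i j → F i j * c)
*-distribʳ-sumℚ² N c F = trans (*-distribʳ-sumℚ N c _) (sumℚ-cong N (λ i _ → *-distribʳ-sumℚ N c (F i)))

sumℚ-rotate : ∀ N (F : ℕ → ℕ → ℕ → ℚ) →
  sumℚ N (λ a → sumℚ² N (F a)) ≡ sumℚ² N (λ b c → sumℚ N (λ a → F a b c))
sumℚ-rotate N F = trans (sumℚ-swap N N (λ a b → sumℚ N (F a b)))
                        (sumℚ-cong N (λ b _ → sumℚ-swap N N (λ a → F a b)))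

δ : ℕ → ℕ → ℚ
δ m i with m ℕ.≟ i
... | yes _ = 1ℚ
... | no  _ = 0ℚ

δ-diag : ∀ m → δ m m ≡ 1ℚ
δ-diag m with m ℕ.≟ m
... | yes _   = refl
... | no  m≢m = ⊥-elim (m≢m refl)

δ-off : ∀ {m i} → m ≢ i → δ m i ≡ 0ℚ
δ-off {m} {i} m≢i with m ℕ.≟ i
... | yes m≡i = ⊥-elim (m≢i m≡i)
... | no  _   = refl

δ-off-* : ∀ {m i} x → m ≢ i → δ m i * x ≡ 0ℚ
δ-off-* x m≢i = trans (cong (_* x) (δ-off m≢i)) (*-zeroˡ x)

δ-resp-⇔ : ∀ {a b c d} → (a ≡ b → c ≡ d) → (c ≡ d → a ≡ b) → δ a b ≡ δ c d
δ-resp-⇔ {a} {b} {c} {d} to from with a ℕ.≟ b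
... | yes a≡b = sym (trans (cong (δ c) (sym (to a≡b))) (δ-diag c))
... | no  a≢b = sym (δ-off (λ c≡d → a≢b (from c≡d)))

δ-sym : ∀ m i → δ m i ≡ δ i m
δ-sym m i = δ-resp-⇔ {m} {i} sym sym

δ-+ : ∀ {i j n} → i ≤ℕ n → δ (i +ℕ j) n ≡ δ (n ∸ i) j
δ-+ {i} {j} i≤n = δ-resp-⇔ (λ e → trans (cong (_∸ i) (sym e)) (ℕP.m+n∸m≡n i j))
                           (λ e → trans (cong (i +ℕ_) (sym e)) (ℕP.m+[n∸m]≡n i≤n))

sumℚ-δ : ∀ N m (F : ℕ → ℚ) → (N <ℕ m → F m ≡ 0ℚ) → sumℚ N (λ k → δ m k * F k) ≡ F m
sumℚ-δ zero m F F≡0 with m ℕ.≟ 0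
... | yes refl = *-identityˡ (F 0)
... | no  m≢0  = trans (*-zeroˡ (F 0)) (sym (F≡0 (ℕP.n≢0⇒n>0 m≢0)))
sumℚ-δ (suc N) m F F≡0 with m ℕ.≟ suc N
... | yes refl = trans
  (cong₂ _+_ (sumℚ-zero N (λ i i≤N → δ-off-* (F i) (λ e → ℕP.<⇒≢ (s≤s i≤N) (sym e)))) (*-identityˡ (F m)))
  (+-identityˡ (F m))
... | no m≢N+1 = trans
  (cong₂ _+_ (sumℚ-δ N m F (λ N<m → F≡0 (ℕP.≤∧≢⇒< N<m (λ e → m≢N+1 (sym e))))) (*-zeroˡ (F (suc N))))
  (+-identityʳ (F m))

-- Power series

-- (f·g)ₙ as a sum over the square [0,N]², the constraint i + j = n being imposed by δ.
square : ℕ → PS → PS → PS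
square N f g n = sumℚ² N (λ i j → δ (i +ℕ j) n * (f i * g j))

mulS≡square : ∀ N f g n → n ≤ℕ N → mulS f g n ≡ square N f g n
mulS≡square N f g n n≤N = sym (begin
  sumℚ N row        ≡⟨ sumℚ-extend n≤N (λ i n<i _ → row-beyond i n<i) ⟩
  sumℚ n row        ≡⟨ sumℚ-cong n (λ i i≤n → row-within i i≤n) ⟩
  mulS f g n        ∎)
  where
  row : ℕ → ℚ
  row i = sumℚ N (λ j → δ (i +ℕ j) n * (f i * g j))
  row-within : ∀ i → i ≤ℕ n → row i ≡ f i * g (n ∸ i)
  row-within i i≤n = trans (sumℚ-cong N (λ j _ → cong (_* (f i * g j)) (δ-+ i≤n)))
    (sumℚ-δ N (n ∸ i) (λ j → f i * g j) (λ N<n∸i → ⊥-elim (ℕP.<⇒≱ N<n∸i (ℕP.≤-trans (ℕP.m∸n≤m n i) n≤N))))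
  row-beyond : ∀ i → n <ℕ i → row i ≡ 0ℚ
  row-beyond i n<i = sumℚ-zero N (λ j _ → δ-off-* (f i * g j) (λ e → ℕP.<⇒≱ n<i (subst (i ≤ℕ_) e (ℕP.m≤m+n i j))))

mulS-cong : ∀ {f f′ g g′ : PS} → (∀ i → f i ≡ f′ i) → (∀ i → g i ≡ g′ i) → ∀ n → mulS f g n ≡ mulS f′ g′ n
mulS-cong f≡f′ g≡g′ n = sumℚ-cong n (λ i _ → cong₂ _*_ (f≡f′ i) (g≡g′ (n ∸ i)))

mulS-comm : ∀ f g n → mulS f g n ≡ mulS g f n
mulS-comm f g n = begin
  mulS f g n     ≡⟨ mulS≡square n f g n ℕP.≤-refl ⟩
  square n f g n ≡⟨ sumℚ-swap n n _ ⟩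
  sumℚ² n (λ j i → δ (i +ℕ j) n * (f i * g j))
    ≡⟨ sumℚ²-cong n (λ j i _ _ → cong₂ _*_ (cong (λ s → δ s n) (ℕP.+-comm i j)) (*-comm (f i) (g j))) ⟩
  square n g f n ≡⟨ sym (mulS≡square n g f n ℕP.≤-refl) ⟩
  mulS g f n     ∎

-- No side condition is needed: for s > n both sides vanish.
sift-+ : ∀ n s l (φ : ℕ → ℚ) → sumℚ n (λ k → δ s k * (δ (k +ℕ l) n * φ k)) ≡ δ (s +ℕ l) n * φ s
sift-+ n s l φ = sumℚ-δ n s (λ k → δ (k +ℕ l) n * φ k)
  (λ n<s → δ-off-* (φ s) (λ e → ℕP.<⇒≱ n<s (subst (s ≤ℕ_) e (ℕP.m≤m+n s l))))

mulS-assoc : ∀ a b c n → mulS (mulS a b) c n ≡ mulS a (mulS b c) n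
mulS-assoc a b c n = begin
  mulS (mulS a b) c n
    ≡⟨ mulS≡square n (mulS a b) c n ℕP.≤-refl ⟩
  sumℚ² n (λ k l → δ (k +ℕ l) n * (mulS a b k * c l))
    ≡⟨ sumℚ²-cong n (λ k l k≤n _ → expand-left k l k≤n) ⟩
  sumℚ² n (λ k l → sumℚ² n (λ i j → δ (i +ℕ j) k * (δ (k +ℕ l) n * ((a i * b j) * c l))))
    ≡⟨ sumℚ-cong n (λ k _ → sumℚ-rotate n _) ⟩
  sumℚ n (λ k → sumℚ² n (λ i j → sumℚ n (λ l → δ (i +ℕ j) k * (δ (k +ℕ l) n * ((a i * b j) * c l)))))
    ≡⟨ trans (sumℚ-rotate n _) (sumℚ²-cong n (λ i j _ _ → sumℚ-swap n n _)) ⟩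
  sumℚ² n (λ i j → sumℚ n (λ l → sumℚ n (λ k → δ (i +ℕ j) k * (δ (k +ℕ l) n * ((a i * b j) * c l)))))
    ≡⟨ sumℚ²-cong n (λ i j _ _ → sumℚ-cong n (λ l _ → sift-+ n (i +ℕ j) l (λ _ → (a i * b j) * c l))) ⟩
  sumℚ² n (λ i j → sumℚ n (λ l → δ (i +ℕ j +ℕ l) n * ((a i * b j) * c l)))
    ≡⟨ sumℚ²-cong n (λ i j _ _ → sumℚ-cong n (λ l _ →
         cong₂ _*_ (cong (λ s → δ s n) (ℕP.+-assoc i j l)) (*-assoc (a i) (b j) (c l)))) ⟩
  sumℚ² n (λ i j → sumℚ n (λ l → δ (i +ℕ (j +ℕ l)) n * (a i * (b j * c l))))
    ≡⟨ sumℚ-cong n (λ i _ → sumℚ²-cong n (λ j l _ _ → sym (trans (sift-+ n (j +ℕ l) i (λ _ → a i * (b j * c l)))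
         (cong (λ s → δ s n * (a i * (b j * c l))) (ℕP.+-comm (j +ℕ l) i))))) ⟩
  sumℚ n (λ i → sumℚ² n (λ j l → sumℚ n (λ m → δ (j +ℕ l) m * (δ (m +ℕ i) n * (a i * (b j * c l))))))
    ≡⟨ sumℚ-cong n (λ i _ → sym (sumℚ-rotate n _)) ⟩
  sumℚ² n (λ i m → sumℚ² n (λ j l → δ (j +ℕ l) m * (δ (m +ℕ i) n * (a i * (b j * c l)))))
    ≡⟨ sumℚ²-cong n (λ i m _ m≤n → sym (expand-right i m m≤n)) ⟩
  sumℚ² n (λ i m → δ (i +ℕ m) n * (a i * mulS b c m))
    ≡⟨ sym (mulS≡square n a (mulS b c) n ℕP.≤-refl) ⟩
  mulS a (mulS b c) n ∎
  where
  expand-left : ∀ k l → k ≤ℕ n → δ (k +ℕ l) n * (mulS a b k * c l)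
              ≡ sumℚ² n (λ i j → δ (i +ℕ j) k * (δ (k +ℕ l) n * ((a i * b j) * c l)))
  expand-left k l k≤n = begin
    δ (k +ℕ l) n * (mulS a b k * c l)
      ≡⟨ cong (λ x → δ (k +ℕ l) n * (x * c l)) (mulS≡square n a b k k≤n) ⟩
    δ (k +ℕ l) n * (square n a b k * c l)
      ≡⟨ cong (δ (k +ℕ l) n *_) (*-distribʳ-sumℚ² n (c l) _) ⟩
    δ (k +ℕ l) n * sumℚ² n (λ i j → (δ (i +ℕ j) k * (a i * b j)) * c l)
      ≡⟨ *-distribˡ-sumℚ² n (δ (k +ℕ l) n) _ ⟩
    sumℚ² n (λ i j → δ (k +ℕ l) n * ((δ (i +ℕ j) k * (a i * b j)) * c l))
      ≡⟨ sumℚ²-cong n (λ i j _ _ → reorder (δ (k +ℕ l) n) (δ (i +ℕ j) k) (a i * b j) (c l)) ⟩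
    sumℚ² n (λ i j → δ (i +ℕ j) k * (δ (k +ℕ l) n * ((a i * b j) * c l))) ∎
    where
    reorder : ∀ x y z w → x * ((y * z) * w) ≡ y * (x * (z * w))
    reorder = solve-∀ ℚ-ring
  expand-right : ∀ i m → m ≤ℕ n → δ (i +ℕ m) n * (a i * mulS b c m)
               ≡ sumℚ² n (λ j l → δ (j +ℕ l) m * (δ (m +ℕ i) n * (a i * (b j * c l))))
  expand-right i m m≤n = begin
    δ (i +ℕ m) n * (a i * mulS b c m)
      ≡⟨ cong₂ (λ s x → δ s n * (a i * x)) (ℕP.+-comm i m) (mulS≡square n b c m m≤n) ⟩
    δ (m +ℕ i) n * (a i * square n b c m)
      ≡⟨ cong (δ (m +ℕ i) n *_) (*-distribˡ-sumℚ² n (a i) _) ⟩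
    δ (m +ℕ i) n * sumℚ² n (λ j l → a i * (δ (j +ℕ l) m * (b j * c l)))
      ≡⟨ *-distribˡ-sumℚ² n (δ (m +ℕ i) n) _ ⟩
    sumℚ² n (λ j l → δ (m +ℕ i) n * (a i * (δ (j +ℕ l) m * (b j * c l))))
      ≡⟨ sumℚ²-cong n (λ j l _ _ → reorder (δ (m +ℕ i) n) (a i) (δ (j +ℕ l) m) (b j * c l)) ⟩
    sumℚ² n (λ j l → δ (j +ℕ l) m * (δ (m +ℕ i) n * (a i * (b j * c l)))) ∎
    where
    reorder : ∀ x y z w → x * (y * (z * w)) ≡ z * (x * (y * w))
    reorder = solve-∀ ℚ-ring

mulS-identityˡ : ∀ g n → mulS oneS g n ≡ g n
mulS-identityˡ g n = trans (sumℚ-extend {N = n} {f = λ i → oneS i * g (n ∸ i)} z≤n (λ { (suc i) _ _ → *-zeroˡ (g (n ∸ suc i)) })) (*-identityˡ (g n))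

powS-+ : ∀ h i j n → mulS (powS h i) (powS h j) n ≡ powS h (i +ℕ j) n
powS-+ h zero    j n = mulS-identityˡ (powS h j) n
powS-+ h (suc i) j n = trans (mulS-assoc h (powS h i) (powS h j) n)
  (mulS-cong {h} {h} (λ _ → refl) (powS-+ h i j) n)

powS-vanish : ∀ h → h 0 ≡ 0ℚ → ∀ k n → n <ℕ k → powS h k n ≡ 0ℚ
powS-vanish h h0≡0 (suc k) n n<k+1 = sumℚ-zero n term≡0
  where
  term≡0 : ∀ i → i ≤ℕ n → h i * powS h k (n ∸ i) ≡ 0ℚ
  term≡0 zero    _   = trans (cong (_* powS h k n) h0≡0) (*-zeroˡ (powS h k n))
  term≡0 (suc i) i<n = trans
    (cong (h (suc i) *_) (powS-vanish h h0≡0 k (n ∸ suc i)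
      (ℕP.<-≤-trans (ℕP.∸-monoʳ-< {n} {suc i} {0} (s≤s z≤n) i<n) (ℕP.≤-pred n<k+1))))
    (*-zeroʳ (h (suc i)))

compS-extend : ∀ f h → h 0 ≡ 0ℚ → ∀ n N → n ≤ℕ N → compS f h n ≡ sumℚ N (λ k → f k * powS h k n)
compS-extend f h h0≡0 n N n≤N = sym (sumℚ-extend n≤N
  (λ k n<k _ → trans (cong (f k *_) (powS-vanish h h0≡0 k n n<k)) (*-zeroʳ (f k))))

-- Substituting h into f·g: the square expansion of (f·g)_k is resummed against hᵏ, and hⁱ⁺ʲ = hⁱ·hʲ.
compS-mulS : ∀ f g h → h 0 ≡ 0ℚ → ∀ n → compS (mulS f g) h n ≡ mulS (compS f h) (compS g h) n
compS-mulS f g h h0≡0 n = begin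
  sumℚ n (λ k → mulS f g k * H k n)
    ≡⟨ sumℚ-cong n (λ k k≤n → trans (cong (_* H k n) (mulS≡square n f g k k≤n))
         (trans (*-distribʳ-sumℚ² n (H k n) _) (sumℚ²-cong n (λ i j _ _ → *-assoc (δ (i +ℕ j) k) (f i * g j) (H k n))))) ⟩
  sumℚ n (λ k → sumℚ² n (λ i j → δ (i +ℕ j) k * ((f i * g j) * H k n)))
    ≡⟨ sumℚ-rotate n _ ⟩
  sumℚ² n (λ i j → sumℚ n (λ k → δ (i +ℕ j) k * ((f i * g j) * H k n)))
    ≡⟨ sumℚ²-cong n (λ i j _ _ → sumℚ-δ n (i +ℕ j) (λ k → (f i * g j) * H k n)
         (λ n<i+j → trans (cong ((f i * g j) *_) (powS-vanish h h0≡0 (i +ℕ j) n n<i+j)) (*-zeroʳ (f i * g j)))) ⟩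
  sumℚ² n (λ i j → (f i * g j) * H (i +ℕ j) n)
    ≡⟨ sumℚ²-cong n (λ i j _ _ → trans (cong ((f i * g j) *_) (trans (sym (powS-+ h i j n)) (mulS≡square n (H i) (H j) n ℕP.≤-refl)))
         (*-distribˡ-sumℚ² n (f i * g j) _)) ⟩
  sumℚ² n (λ i j → sumℚ² n (λ a b → (f i * g j) * (δ (a +ℕ b) n * (H i a * H j b))))
    ≡⟨ sym (trans (sumℚ-cong n (λ a _ → sumℚ-rotate n _)) (sumℚ-rotate n _)) ⟩
  sumℚ² n (λ a b → sumℚ² n (λ i j → (f i * g j) * (δ (a +ℕ b) n * (H i a * H j b))))
    ≡⟨ sym (sumℚ²-cong n (λ a b a≤n b≤n → expand a b a≤n b≤n)) ⟩
  square n (compS f h) (compS g h) n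
    ≡⟨ sym (mulS≡square n (compS f h) (compS g h) n ℕP.≤-refl) ⟩
  mulS (compS f h) (compS g h) n ∎
  where
  H : ℕ → PS
  H = powS h
  expand : ∀ a b → a ≤ℕ n → b ≤ℕ n → δ (a +ℕ b) n * (compS f h a * compS g h b)
         ≡ sumℚ² n (λ i j → (f i * g j) * (δ (a +ℕ b) n * (H i a * H j b)))
  expand a b a≤n b≤n = begin
    δ (a +ℕ b) n * (compS f h a * compS g h b)
      ≡⟨ cong (δ (a +ℕ b) n *_) (cong₂ _*_ (compS-extend f h h0≡0 a n a≤n) (compS-extend g h h0≡0 b n b≤n)) ⟩
    δ (a +ℕ b) n * (sumℚ n (λ i → f i * H i a) * sumℚ n (λ j → g j * H j b))
      ≡⟨ cong (δ (a +ℕ b) n *_) (trans (*-distribʳ-sumℚ n _ _) (sumℚ-cong n (λ i _ → *-distribˡ-sumℚ n (f i * H i a) _))) ⟩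
    δ (a +ℕ b) n * sumℚ² n (λ i j → (f i * H i a) * (g j * H j b))
      ≡⟨ *-distribˡ-sumℚ² n (δ (a +ℕ b) n) _ ⟩
    sumℚ² n (λ i j → δ (a +ℕ b) n * ((f i * H i a) * (g j * H j b)))
      ≡⟨ sumℚ²-cong n (λ i j _ _ → reorder (δ (a +ℕ b) n) (f i) (H i a) (g j) (H j b)) ⟩
    sumℚ² n (λ i j → (f i * g j) * (δ (a +ℕ b) n * (H i a * H j b))) ∎
    where
    reorder : ∀ d x y z w → d * ((x * y) * (z * w)) ≡ (x * z) * (d * (y * w))
    reorder = solve-∀ ℚ-ring

powS-compS : ∀ f h → h 0 ≡ 0ℚ → ∀ k n → powS (compS f h) k n ≡ compS (powS f k) h n
powS-compS f h h0≡0 zero    n = sym (trans (sumℚ-extend {N = n} {f = λ k → oneS k * powS h k n} z≤n (λ { (suc i) _ _ → *-zeroˡ (powS h (suc i) n) }))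
                                           (*-identityˡ (oneS n)))
powS-compS f h h0≡0 (suc k) n = trans (mulS-cong {compS f h} {compS f h} (λ _ → refl) (powS-compS f h h0≡0 k) n)
  (sym (compS-mulS f (powS f k) h h0≡0 n))

-- The embedding ℕ → ℚ

ℕtoℚ≡mkℚ : ∀ n → ℕtoℚ n ≡ mkℚ (ℤ.+ n) 0 (C.sym (C.1-coprimeTo n))
ℕtoℚ≡mkℚ n = normalize-coprime (C.sym (C.1-coprimeTo n))

ℕtoℚ-+ : ∀ a b → ℕtoℚ (a +ℕ b) ≡ ℕtoℚ a + ℕtoℚ b
ℕtoℚ-+ a b = sym (trans (cong₂ _+_ (ℕtoℚ≡mkℚ a) (ℕtoℚ≡mkℚ b))
  (cong (_/ 1) (cong₂ ℤ._+_ (ℤP.*-identityʳ (ℤ.+ a)) (ℤP.*-identityʳ (ℤ.+ b)))))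

ℕtoℚ-* : ∀ a b → ℕtoℚ (a *ℕ b) ≡ ℕtoℚ a * ℕtoℚ b
ℕtoℚ-* a b = sym (trans (cong₂ _*_ (ℕtoℚ≡mkℚ a) (ℕtoℚ≡mkℚ b)) (cong (_/ 1) (sym (ℤP.pos-* a b))))

ℕtoℚ-sumℕ : ∀ n (f : ℕ → ℕ) → ℕtoℚ (sumℕ n f) ≡ sumℚ n (λ i → ℕtoℚ (f i))
ℕtoℚ-sumℕ zero    f = refl
ℕtoℚ-sumℕ (suc n) f = trans (ℕtoℚ-+ (sumℕ n f) (f (suc n))) (cong (_+ ℕtoℚ (f (suc n))) (ℕtoℚ-sumℕ n f))

ℕtoℚ-mono-≤ : ∀ {a b} → a ≤ℕ b → ℕtoℚ a ≤ ℕtoℚ b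
ℕtoℚ-mono-≤ {a} {b} a≤b = subst₂ _≤_ (sym (ℕtoℚ≡mkℚ a)) (sym (ℕtoℚ≡mkℚ b))
  (*≤* (ℤP.*-monoʳ-≤-nonNeg (ℤ.+ 1) (ℤ.+≤+ a≤b)))

ℕtoℚ-mono-< : ∀ {a b} → a <ℕ b → ℕtoℚ a < ℕtoℚ b
ℕtoℚ-mono-< {a} {b} a<b = subst₂ _<_ (sym (ℕtoℚ≡mkℚ a)) (sym (ℕtoℚ≡mkℚ b))
  (*<* (ℤP.*-monoʳ-<-pos (ℤ.+ 1) (ℤ.+<+ a<b)))

0≤ℕtoℚ : ∀ a → 0ℚ ≤ ℕtoℚ a
0≤ℕtoℚ a = ℕtoℚ-mono-≤ {0} {a} z≤n

ℕtoℚ*1/ℕ≡1 : ∀ d .{{_ : ℕ.NonZero d}} → ℕtoℚ d * (ℤ.+ 1 / d) ≡ 1ℚ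
ℕtoℚ*1/ℕ≡1 (suc d) = trans (cong₂ _*_ (ℕtoℚ≡mkℚ (suc d)) (normalize-coprime (C.1-coprimeTo (suc d))))
  (*-inverseʳ (mkℚ (ℤ.+ suc d) 0 (C.sym (C.1-coprimeTo (suc d)))))

ℕtoℚ[k!]*invFact[k]≡1 : ∀ k → ℕtoℚ (k !) * invFact k ≡ 1ℚ
ℕtoℚ[k!]*invFact[k]≡1 k = ℕtoℚ*1/ℕ≡1 (k !) {{k ℕP.!≢0}}

-- Binomial coefficients and Stirling numbers

[n+1]C[k+1]≡nCk+nC[k+1] : ∀ n k → suc n C suc k ≡ n C k +ℕ n C suc k
[n+1]C[k+1]≡nCk+nC[k+1] n k = sym (nCk+nC[k+1]≡[n+1]C[k+1] n k)

nCk*k![n∸k]!≡n! : ∀ {n k} → k ≤ℕ n → (n C k) *ℕ (k ! *ℕ (n ∸ k) !) ≡ n !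
nCk*k![n∸k]!≡n! {n} {k} k≤n = trans (cong (_*ℕ (k ! *ℕ (n ∸ k) !)) (nCk≡n!/k![n-k]! k≤n))
  (m/n*n≡m {{ℕP.m*n≢0 (k !) ((n ∸ k) !) {{k ℕP.!≢0}} {{(n ∸ k) ℕP.!≢0}}}} (k![n∸k]!∣n! k≤n))

n*nCk≡[k+1]*nC[k+1]+k*nCk : ∀ n k → n *ℕ (n C k) ≡ suc k *ℕ (n C suc k) +ℕ k *ℕ (n C k)
n*nCk≡[k+1]*nC[k+1]+k*nCk n       zero    = sym (trans (ℕP.+-identityʳ (1 *ℕ (n C 1)))
                                                   (trans (ℕP.*-identityˡ (n C 1)) (trans (nC1≡n n) (sym (ℕP.*-identityʳ n)))))
n*nCk≡[k+1]*nC[k+1]+k*nCk zero    (suc k) = sym (cong₂ _+ℕ_ (ℕP.*-zeroʳ (suc (suc k))) (ℕP.*-zeroʳ (suc k)))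
n*nCk≡[k+1]*nC[k+1]+k*nCk (suc n) (suc k) = begin
  suc n *ℕ (suc n C suc k)
    ≡⟨ cong (suc n *ℕ_) ([n+1]C[k+1]≡nCk+nC[k+1] n k) ⟩
  suc n *ℕ (c₀ +ℕ c₁)
    ≡⟨ distribute n c₀ c₁ ⟩
  n *ℕ c₀ +ℕ n *ℕ c₁ +ℕ c₀ +ℕ c₁
    ≡⟨ cong₂ (λ u v → u +ℕ v +ℕ c₀ +ℕ c₁) (n*nCk≡[k+1]*nC[k+1]+k*nCk n k) (n*nCk≡[k+1]*nC[k+1]+k*nCk n (suc k)) ⟩
  (suc k *ℕ c₁ +ℕ k *ℕ c₀) +ℕ (suc (suc k) *ℕ c₂ +ℕ suc k *ℕ c₁) +ℕ c₀ +ℕ c₁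
    ≡⟨ regroup k c₀ c₁ c₂ ⟩
  suc (suc k) *ℕ (c₁ +ℕ c₂) +ℕ suc k *ℕ (c₀ +ℕ c₁)
    ≡⟨ sym (cong₂ (λ u v → suc (suc k) *ℕ u +ℕ suc k *ℕ v) ([n+1]C[k+1]≡nCk+nC[k+1] n (suc k)) ([n+1]C[k+1]≡nCk+nC[k+1] n k)) ⟩
  suc (suc k) *ℕ (suc n C suc (suc k)) +ℕ suc k *ℕ (suc n C suc k) ∎
  where
  c₀ = n C k
  c₁ = n C suc k
  c₂ = n C suc (suc k)
  distribute : ∀ n x y → suc n *ℕ (x +ℕ y) ≡ n *ℕ x +ℕ n *ℕ y +ℕ x +ℕ y
  distribute = NS.solve-∀
  regroup : ∀ k x y z → (suc k *ℕ y +ℕ k *ℕ x) +ℕ (suc (suc k) *ℕ z +ℕ suc k *ℕ y) +ℕ x +ℕ y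
                      ≡ suc (suc k) *ℕ (y +ℕ z) +ℕ suc k *ℕ (x +ℕ y)
  regroup = NS.solve-∀

nCk≤2^n : ∀ n k → n C k ≤ℕ 2 ^ℕ n
nCk≤2^n n       zero    = ℕP.m^n>0 2 n
nCk≤2^n zero    (suc k) = z≤n
nCk≤2^n (suc n) (suc k) = subst₂ _≤ℕ_ (nCk+nC[k+1]≡[n+1]C[k+1] n k) (cong (2 ^ℕ n +ℕ_) (sym (ℕP.+-identityʳ (2 ^ℕ n))))
  (ℕP.+-mono-≤ (nCk≤2^n n k) (nCk≤2^n n (suc k)))

[n∸k]*nCk≡[k+1]*nC[k+1] : ∀ n k → (n ∸ k) *ℕ (n C k) ≡ suc k *ℕ (n C suc k)
[n∸k]*nCk≡[k+1]*nC[k+1] n k = begin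
  (n ∸ k) *ℕ (n C k)                                ≡⟨ ℕP.*-distribʳ-∸ (n C k) n k ⟩
  n *ℕ (n C k) ∸ k *ℕ (n C k)                       ≡⟨ cong (_∸ k *ℕ (n C k)) (n*nCk≡[k+1]*nC[k+1]+k*nCk n k) ⟩
  suc k *ℕ (n C suc k) +ℕ k *ℕ (n C k) ∸ k *ℕ (n C k) ≡⟨ ℕP.m+n∸n≡m (suc k *ℕ (n C suc k)) (k *ℕ (n C k)) ⟩
  suc k *ℕ (n C suc k)                              ∎

Sℚ : ℕ → ℕ → ℚ
Sℚ n m = ℕtoℚ (S n m)

Cℚ : ℕ → ℕ → ℚ
Cℚ n k = ℕtoℚ (n C k)

factℚ : ℕ → ℚ
factℚ k = ℕtoℚ (k !)

Spowℚ : ℕ → ℕ → ℕ → ℚ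
Spowℚ p n m = ℕtoℚ (Spow p n m)

n<m⇒S[n,m]≡0 : ∀ {n m} → n <ℕ m → S n m ≡ 0
n<m⇒S[n,m]≡0 {zero}  {suc m} _         = refl
n<m⇒S[n,m]≡0 {suc n} {suc m} (s≤s n<m) rewrite n<m⇒S[n,m]≡0 (ℕP.m≤n⇒m≤1+n n<m) | n<m⇒S[n,m]≡0 n<m =
  trans (ℕP.+-identityʳ (m *ℕ 0)) (ℕP.*-zeroʳ m)

Sℚ-suc : ∀ n m → Sℚ (suc n) (suc m) ≡ ℕtoℚ (suc m) * Sℚ n (suc m) + Sℚ n m
Sℚ-suc n m = trans (ℕtoℚ-+ (suc m *ℕ S n (suc m)) (S n m)) (cong (_+ Sℚ n m) (ℕtoℚ-* (suc m) (S n (suc m))))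

Cℚ-suc : ∀ n k → Cℚ (suc n) (suc k) ≡ Cℚ n k + Cℚ n (suc k)
Cℚ-suc n k = trans (cong ℕtoℚ ([n+1]C[k+1]≡nCk+nC[k+1] n k)) (ℕtoℚ-+ (n C k) (n C suc k))

Cℚ-absorption : ∀ k j → ℕtoℚ k * Cℚ k j ≡ ℕtoℚ (suc j) * Cℚ k (suc j) + ℕtoℚ j * Cℚ k j
Cℚ-absorption k j = begin
  ℕtoℚ k * Cℚ k j                                ≡⟨ sym (ℕtoℚ-* k (k C j)) ⟩
  ℕtoℚ (k *ℕ (k C j))                            ≡⟨ cong ℕtoℚ (n*nCk≡[k+1]*nC[k+1]+k*nCk k j) ⟩
  ℕtoℚ (suc j *ℕ (k C suc j) +ℕ j *ℕ (k C j))    ≡⟨ ℕtoℚ-+ (suc j *ℕ (k C suc j)) (j *ℕ (k C j)) ⟩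
  ℕtoℚ (suc j *ℕ (k C suc j)) + ℕtoℚ (j *ℕ (k C j))
    ≡⟨ cong₂ _+_ (ℕtoℚ-* (suc j) (k C suc j)) (ℕtoℚ-* j (k C j)) ⟩
  ℕtoℚ (suc j) * Cℚ k (suc j) + ℕtoℚ j * Cℚ k j ∎

factℚ-split : ∀ {n i} → i ≤ℕ n → factℚ n ≡ Cℚ n i * (factℚ i * factℚ (n ∸ i))
factℚ-split {n} {i} i≤n = trans (cong ℕtoℚ (sym (nCk*k![n∸k]!≡n! i≤n)))
  (trans (ℕtoℚ-* (n C i) _) (cong (Cℚ n i *_) (ℕtoℚ-* (i !) ((n ∸ i) !))))

-- S(n+1, j+1) = Σᵢ C(n,i) S(i,j): choose the i elements not in the block of the new element.
S-binomial-recurrence : ∀ n j → sumℚ n (λ i → Cℚ n i * Sℚ i j) ≡ Sℚ (suc n) (suc j)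
S-binomial-recurrence zero    j = trans (*-identityˡ (Sℚ 0 j))
  (cong ℕtoℚ (sym (cong (_+ℕ S 0 j) (ℕP.*-zeroʳ (suc j)))))
S-binomial-recurrence (suc n) j = begin
  sumℚ (suc n) (λ i → Cℚ (suc n) i * Sℚ i j)
    ≡⟨ sumℚ-head n _ ⟩
  1ℚ * Sℚ 0 j + sumℚ n (λ i → Cℚ (suc n) (suc i) * Sℚ (suc i) j)
    ≡⟨ cong (1ℚ * Sℚ 0 j +_) (trans (sumℚ-cong n (λ i _ → trans (cong (_* Sℚ (suc i) j) (Cℚ-suc n i))
         (*-distribʳ-+ (Sℚ (suc i) j) (Cℚ n i) (Cℚ n (suc i))))) (sumℚ-distrib-+ n _ _)) ⟩
  1ℚ * Sℚ 0 j + (shifted j + R)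
    ≡⟨ regroup (1ℚ * Sℚ 0 j) (shifted j) R ⟩
  shifted j + (1ℚ * Sℚ 0 j + R)
    ≡⟨ cong (shifted j +_) (sym (sumℚ-head n (λ i → Cℚ n i * Sℚ i j))) ⟩
  shifted j + sumℚ (suc n) (λ i → Cℚ n i * Sℚ i j)
    ≡⟨ cong (shifted j +_) (sumℚ-extend (ℕP.n≤1+n n) (λ { i n<i i≤n+1 →
         trans (cong (λ c → ℕtoℚ c * Sℚ i j) (k>n⇒nCk≡0 n<i)) (*-zeroˡ (Sℚ i j)) })) ⟩
  shifted j + sumℚ n (λ i → Cℚ n i * Sℚ i j)
    ≡⟨ cong (shifted j +_) (S-binomial-recurrence n j) ⟩
  shifted j + Sℚ (suc n) (suc j)
    ≡⟨ shifted-step j ⟩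
  Sℚ (suc (suc n)) (suc j) ∎
  where
  shifted : ℕ → ℚ
  shifted j = sumℚ n (λ i → Cℚ n i * Sℚ (suc i) j)
  R : ℚ
  R = sumℚ n (λ i → Cℚ n (suc i) * Sℚ (suc i) j)
  regroup : ∀ a q r → a + (q + r) ≡ q + (a + r)
  regroup = solve-∀ ℚ-ring
  shifted-step : ∀ j → shifted j + Sℚ (suc n) (suc j) ≡ Sℚ (suc (suc n)) (suc j)
  shifted-step zero = begin
    sumℚ n (λ i → Cℚ n i * 0ℚ) + Sℚ (suc n) 1
      ≡⟨ cong (_+ Sℚ (suc n) 1) (sumℚ-zero n (λ i _ → *-zeroʳ (Cℚ n i))) ⟩
    0ℚ + Sℚ (suc n) 1
      ≡⟨ +-identityˡ _ ⟩
    Sℚ (suc n) 1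
      ≡⟨ cong ℕtoℚ (sym (trans (ℕP.+-identityʳ (1 *ℕ S (suc n) 1)) (ℕP.*-identityˡ (S (suc n) 1)))) ⟩
    Sℚ (suc (suc n)) 1 ∎
  shifted-step (suc j) = begin
    sumℚ n (λ i → Cℚ n i * Sℚ (suc i) (suc j)) + A
      ≡⟨ cong (_+ A) (trans (sumℚ-cong n (λ i _ → trans (cong (Cℚ n i *_) (Sℚ-suc i j))
           (distribute (Cℚ n i) c (Sℚ i (suc j)) (Sℚ i j)))) (sumℚ-distrib-+ n _ _)) ⟩
    (sumℚ n (λ i → c * (Cℚ n i * Sℚ i (suc j))) + sumℚ n (λ i → Cℚ n i * Sℚ i j)) + A
      ≡⟨ cong₂ (λ u v → (u + v) + A)
           (trans (sym (*-distribˡ-sumℚ n c _)) (cong (c *_) (S-binomial-recurrence n (suc j))))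
           (S-binomial-recurrence n j) ⟩
    (c * A + B) + A
      ≡⟨ collect c A B ⟩
    (1ℚ + c) * A + B
      ≡⟨ cong (λ x → x * A + B) (sym (ℕtoℚ-+ 1 (suc j))) ⟩
    ℕtoℚ (suc (suc j)) * A + B
      ≡⟨ sym (Sℚ-suc (suc n) (suc j)) ⟩
    Sℚ (suc (suc n)) (suc (suc j)) ∎
    where
    c = ℕtoℚ (suc j)
    A = Sℚ (suc n) (suc (suc j))
    B = Sℚ (suc n) (suc j)
    distribute : ∀ b c x y → b * (c * x + y) ≡ c * (b * x) + b * y
    distribute = solve-∀ ℚ-ring
    collect : ∀ c a b → (c * a + b) + a ≡ (1ℚ + c) * a + b
    collect = solve-∀ ℚ-ring

sumℚ-Cℚ*Sℚ-below : ∀ N j → sumℚ N (λ i → Cℚ (suc N) i * Sℚ i j) ≡ ℕtoℚ (suc j) * Sℚ (suc N) (suc j)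
sumℚ-Cℚ*Sℚ-below N j = +-cancelʳ (Sℚ (suc N) j) _ _ (begin
  sumℚ N (λ i → Cℚ (suc N) i * Sℚ i j) + Sℚ (suc N) j
    ≡⟨ cong (sumℚ N (λ i → Cℚ (suc N) i * Sℚ i j) +_)
         (sym (trans (cong (λ c → ℕtoℚ c * Sℚ (suc N) j) (nCn≡1 (suc N))) (*-identityˡ (Sℚ (suc N) j)))) ⟩
  sumℚ (suc N) (λ i → Cℚ (suc N) i * Sℚ i j)
    ≡⟨ S-binomial-recurrence (suc N) j ⟩
  Sℚ (suc (suc N)) (suc j)
    ≡⟨ Sℚ-suc (suc N) j ⟩
  ℕtoℚ (suc j) * Sℚ (suc N) (suc j) + Sℚ (suc N) j ∎)

expm1S-pow : ∀ j n → factℚ n * powS expm1S j n ≡ factℚ j * Sℚ n j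
expm1S-pow zero    zero    = refl
expm1S-pow zero    (suc n) = trans (*-zeroʳ (factℚ (suc n))) (sym (*-zeroʳ 1ℚ))
expm1S-pow (suc j) zero    = trans (cong (1ℚ *_) (*-zeroˡ (powS expm1S j 0)))
  (trans (*-zeroʳ 1ℚ) (sym (*-zeroʳ (factℚ (suc j)))))
expm1S-pow (suc j) (suc N) = begin
  factℚ n * mulS expm1S (powS expm1S j) n
    ≡⟨ cong (factℚ n *_) (mulS-comm expm1S (powS expm1S j) n) ⟩
  factℚ n * sumℚ n (λ i → powS expm1S j i * expm1S (n ∸ i))
    ≡⟨ *-distribˡ-sumℚ n (factℚ n) _ ⟩
  sumℚ n (λ i → factℚ n * (powS expm1S j i * expm1S (n ∸ i)))
    ≡⟨ sumℚ-cong n (λ i i≤n → trans (cong (_* (powS expm1S j i * expm1S (n ∸ i))) (factℚ-split i≤n))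
         (trans (reorder (Cℚ n i) (factℚ i) (factℚ (n ∸ i)) (powS expm1S j i) (expm1S (n ∸ i)))
                (cong (λ x → Cℚ n i * (x * (factℚ (n ∸ i) * expm1S (n ∸ i)))) (expm1S-pow j i)))) ⟩
  sumℚ N (λ i → term i) + term n
    ≡⟨ cong₂ _+_ (sumℚ-cong N (λ i i≤N → term-below i i≤N)) last-term ⟩
  sumℚ N (λ i → Cℚ n i * (factℚ j * Sℚ i j)) + 0ℚ
    ≡⟨ +-identityʳ _ ⟩
  sumℚ N (λ i → Cℚ n i * (factℚ j * Sℚ i j))
    ≡⟨ trans (sumℚ-cong N (λ i _ → swap (Cℚ n i) (factℚ j) (Sℚ i j))) (sym (*-distribˡ-sumℚ N (factℚ j) _)) ⟩
  factℚ j * sumℚ N (λ i → Cℚ n i * Sℚ i j)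
    ≡⟨ cong (factℚ j *_) (sumℚ-Cℚ*Sℚ-below N j) ⟩
  factℚ j * (ℕtoℚ (suc j) * Sℚ n (suc j))
    ≡⟨ sym (*-assoc (factℚ j) _ _) ⟩
  (factℚ j * ℕtoℚ (suc j)) * Sℚ n (suc j)
    ≡⟨ cong (_* Sℚ n (suc j)) (trans (*-comm (factℚ j) _) (sym (ℕtoℚ-* (suc j) (j !)))) ⟩
  factℚ (suc j) * Sℚ n (suc j) ∎
  where
  n = suc N
  term : ℕ → ℚ
  term i = Cℚ n i * ((factℚ j * Sℚ i j) * (factℚ (n ∸ i) * expm1S (n ∸ i)))
  weight : ∀ {m k} → m ≡ suc k → factℚ m * expm1S m ≡ 1ℚ
  weight {k = k} refl = ℕtoℚ[k!]*invFact[k]≡1 (suc k)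
  term-below : ∀ i → i ≤ℕ N → term i ≡ Cℚ n i * (factℚ j * Sℚ i j)
  term-below i i≤N = cong (Cℚ n i *_)
    (trans (cong ((factℚ j * Sℚ i j) *_) (weight (ℕP.+-∸-assoc 1 i≤N))) (*-identityʳ (factℚ j * Sℚ i j)))
  last-term : term n ≡ 0ℚ
  last-term = trans (cong (λ m → Cℚ n n * ((factℚ j * Sℚ n j) * (factℚ m * expm1S m))) (ℕP.n∸n≡0 n))
    (trans (cong (λ x → Cℚ n n * x) (*-zeroʳ (factℚ j * Sℚ n j))) (*-zeroʳ (Cℚ n n)))
  reorder : ∀ b x y a e → (b * (x * y)) * (a * e) ≡ b * ((x * a) * (y * e))
  reorder = solve-∀ ℚ-ring
  swap : ∀ b x y → b * (x * y) ≡ x * (b * y)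
  swap = solve-∀ ℚ-ring

-- kᵐ = Σⱼ S(m,j) k(k-1)⋯(k-j+1), and k(k-1)⋯(k-j+1) = j! C(k,j).
powℚ≡sumℚ-Stirling : ∀ k m → powℚ (ℕtoℚ k) m ≡ sumℚ m (λ j → (Sℚ m j * factℚ j) * Cℚ k j)
powℚ≡sumℚ-Stirling k zero    = refl
powℚ≡sumℚ-Stirling k (suc m) = begin
  K * powℚ K m
    ≡⟨ cong (K *_) (powℚ≡sumℚ-Stirling k m) ⟩
  K * sumℚ m (λ j → (Sℚ m j * factℚ j) * Cℚ k j)
    ≡⟨ *-distribˡ-sumℚ m K _ ⟩
  sumℚ m (λ j → K * ((Sℚ m j * factℚ j) * Cℚ k j))
    ≡⟨ sumℚ-cong m (λ j _ → absorb j) ⟩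
  sumℚ m (λ j → up j + g j)
    ≡⟨ sumℚ-distrib-+ m up g ⟩
  sumℚ m up + sumℚ m g
    ≡⟨ cong (sumℚ m up +_) (sumℚ-shift m g (*-zeroˡ ((Sℚ m 0 * factℚ 0) * Cℚ k 0)) g[m+1]≡0) ⟩
  sumℚ m up + sumℚ m (λ j → g (suc j))
    ≡⟨ sym (sumℚ-distrib-+ m up (λ j → g (suc j))) ⟩
  sumℚ m (λ j → up j + g (suc j))
    ≡⟨ sumℚ-cong m (λ j _ → sym (trans (cong (λ s → (s * factℚ (suc j)) * Cℚ k (suc j)) (Sℚ-suc m j))
         (split (ℕtoℚ (suc j)) (Sℚ m (suc j)) (Sℚ m j) (factℚ (suc j)) (Cℚ k (suc j))))) ⟩
  sumℚ m (λ j → (Sℚ (suc m) (suc j) * factℚ (suc j)) * Cℚ k (suc j))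
    ≡⟨ sym (trans (sumℚ-head m _) (+-identityˡ _)) ⟩
  sumℚ (suc m) (λ j → (Sℚ (suc m) j * factℚ j) * Cℚ k j) ∎
  where
  K = ℕtoℚ k
  up g : ℕ → ℚ
  up j = (Sℚ m j * factℚ (suc j)) * Cℚ k (suc j)
  g  j = ℕtoℚ j * ((Sℚ m j * factℚ j) * Cℚ k j)
  swap : ∀ x c b → x * (c * b) ≡ c * (x * b)
  swap = solve-∀ ℚ-ring
  expand : ∀ s f a d c b → (s * f) * (a * d + c * b) ≡ (s * (a * f)) * d + c * ((s * f) * b)
  expand = solve-∀ ℚ-ring
  split : ∀ c s₁ s₀ f b → ((c * s₁ + s₀) * f) * b ≡ (s₀ * f) * b + c * ((s₁ * f) * b)
  split = solve-∀ ℚ-ring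
  absorb : ∀ j → K * ((Sℚ m j * factℚ j) * Cℚ k j) ≡ up j + g j
  absorb j = begin
    K * ((Sℚ m j * factℚ j) * Cℚ k j)
      ≡⟨ swap K (Sℚ m j * factℚ j) (Cℚ k j) ⟩
    (Sℚ m j * factℚ j) * (K * Cℚ k j)
      ≡⟨ cong ((Sℚ m j * factℚ j) *_) (Cℚ-absorption k j) ⟩
    (Sℚ m j * factℚ j) * (ℕtoℚ (suc j) * Cℚ k (suc j) + ℕtoℚ j * Cℚ k j)
      ≡⟨ expand (Sℚ m j) (factℚ j) (ℕtoℚ (suc j)) (Cℚ k (suc j)) (ℕtoℚ j) (Cℚ k j) ⟩
    (Sℚ m j * (ℕtoℚ (suc j) * factℚ j)) * Cℚ k (suc j) + g j
      ≡⟨ cong (λ f → (Sℚ m j * f) * Cℚ k (suc j) + g j) (sym (ℕtoℚ-* (suc j) (j !))) ⟩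
    up j + g j ∎
  g[m+1]≡0 : g (suc m) ≡ 0ℚ
  g[m+1]≡0 = trans (cong (λ s → ℕtoℚ (suc m) * ((ℕtoℚ s * factℚ (suc m)) * Cℚ k (suc m))) (n<m⇒S[n,m]≡0 (ℕP.n<1+n m)))
    (trans (cong (λ x → ℕtoℚ (suc m) * (x * Cℚ k (suc m))) (*-zeroˡ (factℚ (suc m))))
    (trans (cong (ℕtoℚ (suc m) *_) (*-zeroˡ (Cℚ k (suc m)))) (*-zeroʳ (ℕtoℚ (suc m)))))

Spowℚ-suc : ∀ p n m → Spowℚ (suc p) n m ≡ sumℚ n (λ j → Spowℚ p n j * Sℚ j m)
Spowℚ-suc p n m = trans (ℕtoℚ-sumℕ n (λ j → Spow p n j *ℕ S j m))
  (sumℚ-cong n (λ j _ → ℕtoℚ-* (Spow p n j) (S j m)))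

Spowℚ-zero : ∀ n m → Spowℚ 0 n m ≡ δ n m
Spowℚ-zero n m with n ℕ.≟ m
... | yes _ = refl
... | no  _ = refl

Spowℚ-lowerTriangular : ∀ p {n m} → n <ℕ m → Spowℚ p n m ≡ 0ℚ
Spowℚ-lowerTriangular zero    {n} {m} n<m = trans (Spowℚ-zero n m) (δ-off (ℕP.<⇒≢ n<m))
Spowℚ-lowerTriangular (suc p) {n} {m} n<m = trans (Spowℚ-suc p n m) (sumℚ-zero n (λ j j≤n →
  trans (cong (λ s → Spowℚ p n j * ℕtoℚ s) (n<m⇒S[n,m]≡0 (ℕP.≤-<-trans j≤n n<m))) (*-zeroʳ (Spowℚ p n j))))

-- Products of lower triangular matrices, where the sum over j may stop at the row index n.
_⊗_ : (ℕ → ℕ → ℚ) → (ℕ → ℕ → ℚ) → ℕ → ℕ → ℚ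
(A ⊗ B) n m = sumℚ n (λ j → A n j * B j m)

⊗-assoc : ∀ (A B D : ℕ → ℕ → ℚ) → (∀ {i j} → i <ℕ j → B i j ≡ 0ℚ) → ∀ n m → (A ⊗ (B ⊗ D)) n m ≡ ((A ⊗ B) ⊗ D) n m
⊗-assoc A B D B-lower n m = begin
  sumℚ n (λ i → A n i * sumℚ i (λ j → B i j * D j m))
    ≡⟨ sumℚ-cong n (λ i i≤n → cong (A n i *_) (sym (sumℚ-extend i≤n
         (λ j i<j _ → trans (cong (_* D j m) (B-lower i<j)) (*-zeroˡ (D j m)))))) ⟩
  sumℚ n (λ i → A n i * sumℚ n (λ j → B i j * D j m))
    ≡⟨ sumℚ-cong n (λ i _ → *-distribˡ-sumℚ n (A n i) _) ⟩
  sumℚ² n (λ i j → A n i * (B i j * D j m))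
    ≡⟨ sumℚ-swap n n _ ⟩
  sumℚ² n (λ j i → A n i * (B i j * D j m))
    ≡⟨ sumℚ-cong n (λ j _ → trans (sumℚ-cong n (λ i _ → sym (*-assoc (A n i) (B i j) (D j m))))
         (sym (*-distribʳ-sumℚ n (D j m) (λ i → A n i * B i j)))) ⟩
  sumℚ n (λ j → (A ⊗ B) n j * D j m) ∎

Sℚ-⊗-Spowℚ-comm : ∀ p n m → (Sℚ ⊗ Spowℚ p) n m ≡ (Spowℚ p ⊗ Sℚ) n m
Sℚ-⊗-Spowℚ-comm zero n m = begin
  sumℚ n (λ j → Sℚ n j * Spowℚ 0 j m)
    ≡⟨ sumℚ-cong n (λ j _ → trans (cong (Sℚ n j *_) (trans (Spowℚ-zero j m) (δ-sym j m))) (*-comm (Sℚ n j) (δ m j))) ⟩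
  sumℚ n (λ j → δ m j * Sℚ n j)
    ≡⟨ sumℚ-δ n m (Sℚ n) (λ n<m → cong ℕtoℚ (n<m⇒S[n,m]≡0 n<m)) ⟩
  Sℚ n m
    ≡⟨ sym (sumℚ-δ n n (λ j → Sℚ j m) (λ n<n → ⊥-elim (ℕP.<-irrefl refl n<n))) ⟩
  sumℚ n (λ j → δ n j * Sℚ j m)
    ≡⟨ sumℚ-cong n (λ j _ → cong (_* Sℚ j m) (sym (Spowℚ-zero n j))) ⟩
  sumℚ n (λ j → Spowℚ 0 n j * Sℚ j m) ∎
Sℚ-⊗-Spowℚ-comm (suc p) n m = begin
  (Sℚ ⊗ Spowℚ (suc p)) n m ≡⟨ sumℚ-cong n (λ j _ → cong (Sℚ n j *_) (Spowℚ-suc p j m)) ⟩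
  (Sℚ ⊗ (Spowℚ p ⊗ Sℚ)) n m ≡⟨ ⊗-assoc Sℚ (Spowℚ p) Sℚ (Spowℚ-lowerTriangular p) n m ⟩
  ((Sℚ ⊗ Spowℚ p) ⊗ Sℚ) n m ≡⟨ sumℚ-cong n (λ j _ → cong (_* Sℚ j m) (Sℚ-⊗-Spowℚ-comm p n j)) ⟩
  ((Spowℚ p ⊗ Sℚ) ⊗ Sℚ) n m ≡⟨ sumℚ-cong n (λ j _ → cong (_* Sℚ j m) (sym (Spowℚ-suc p n j))) ⟩
  (Spowℚ (suc p) ⊗ Sℚ) n m ∎

-- Higher order Bell polynomials

mulS-tS : ∀ g n → mulS tS g (suc n) ≡ g n
mulS-tS g n = begin
  mulS tS g (suc n)
    ≡⟨ sumℚ-head n _ ⟩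
  0ℚ * g (suc n) + sumℚ n (λ i → tS (suc i) * g (n ∸ i))
    ≡⟨ cong₂ _+_ (*-zeroˡ (g (suc n)))
         (sumℚ-extend {N = n} {f = λ i → tS (suc i) * g (n ∸ i)} z≤n (λ { (suc i) _ _ → *-zeroˡ (g (n ∸ suc i)) })) ⟩
  0ℚ + 1ℚ * g n
    ≡⟨ trans (+-identityˡ _) (*-identityˡ (g n)) ⟩
  g n ∎

powS-tS : ∀ k n → powS tS k n ≡ δ k n
powS-tS zero    zero    = refl
powS-tS zero    (suc n) = refl
powS-tS (suc k) zero    = *-zeroˡ (powS tS k 0)
powS-tS (suc k) (suc n) = trans (mulS-tS (powS tS k) n)
  (trans (powS-tS k n) (δ-resp-⇔ {k} {n} (cong suc) ℕP.suc-injective))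

sigma-pow : ∀ p k n → factℚ n * powS (sigma p) k n ≡ factℚ k * Spowℚ p n k
sigma-pow zero k n = trans (cong (factℚ n *_) (powS-tS k n))
  (trans (diagonal k n) (cong (factℚ k *_) (trans (δ-sym k n) (sym (Spowℚ-zero n k)))))
  where
  diagonal : ∀ k n → factℚ n * δ k n ≡ factℚ k * δ k n
  diagonal k n with k ℕ.≟ n
  ... | yes refl = refl
  ... | no  _    = trans (*-zeroʳ (factℚ n)) (sym (*-zeroʳ (factℚ k)))
sigma-pow (suc p) k n = begin
  factℚ n * powS (compS (sigma p) expm1S) k n
    ≡⟨ cong (factℚ n *_) (powS-compS (sigma p) expm1S refl k n) ⟩
  factℚ n * sumℚ n (λ j → P j * powS expm1S j n)
    ≡⟨ *-distribˡ-sumℚ n (factℚ n) _ ⟩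
  sumℚ n (λ j → factℚ n * (P j * powS expm1S j n))
    ≡⟨ sumℚ-cong n (λ j _ → trans (swap (factℚ n) (P j) (powS expm1S j n)) (cong (P j *_) (expm1S-pow j n))) ⟩
  sumℚ n (λ j → P j * (factℚ j * Sℚ n j))
    ≡⟨ sumℚ-cong n (λ j _ → trans (regroup (P j) (factℚ j) (Sℚ n j)) (cong (_* Sℚ n j) (sigma-pow p k j))) ⟩
  sumℚ n (λ j → (factℚ k * Spowℚ p j k) * Sℚ n j)
    ≡⟨ trans (sumℚ-cong n (λ j _ → trans (*-assoc (factℚ k) _ _) (cong (factℚ k *_) (*-comm _ (Sℚ n j)))))
             (sym (*-distribˡ-sumℚ n (factℚ k) _)) ⟩
  factℚ k * (Sℚ ⊗ Spowℚ p) n k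
    ≡⟨ cong (factℚ k *_) (trans (Sℚ-⊗-Spowℚ-comm p n k) (sym (Spowℚ-suc p n k))) ⟩
  factℚ k * Spowℚ (suc p) n k ∎
  where
  P : ℕ → ℚ
  P j = powS (sigma p) k j
  swap : ∀ f x e → f * (x * e) ≡ x * (f * e)
  swap = solve-∀ ℚ-ring
  regroup : ∀ x f s → x * (f * s) ≡ (f * x) * s
  regroup = solve-∀ ℚ-ring

Bell≡sumℚ-Spowℚ : ∀ p n x → Bell p n x ≡ sumℚ n (λ m → Spowℚ p n m * powℚ x m)
Bell≡sumℚ-Spowℚ p n x = begin
  factℚ n * sumℚ n (λ k → (powℚ x k * invFact k) * powS (sigma p) k n)
    ≡⟨ *-distribˡ-sumℚ n (factℚ n) _ ⟩
  sumℚ n (λ k → factℚ n * ((powℚ x k * invFact k) * powS (sigma p) k n))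
    ≡⟨ sumℚ-cong n (λ k _ → begin
         factℚ n * ((powℚ x k * invFact k) * powS (sigma p) k n)
           ≡⟨ reorder (factℚ n) (powℚ x k) (invFact k) (powS (sigma p) k n) ⟩
         (powℚ x k * invFact k) * (factℚ n * powS (sigma p) k n)
           ≡⟨ cong ((powℚ x k * invFact k) *_) (sigma-pow p k n) ⟩
         (powℚ x k * invFact k) * (factℚ k * Spowℚ p n k)
           ≡⟨ cancel (powℚ x k) (invFact k) (factℚ k) (Spowℚ p n k) ⟩
         (factℚ k * invFact k) * (Spowℚ p n k * powℚ x k)
           ≡⟨ trans (cong (_* (Spowℚ p n k * powℚ x k)) (ℕtoℚ[k!]*invFact[k]≡1 k)) (*-identityˡ _) ⟩
         Spowℚ p n k * powℚ x k ∎) ⟩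
  sumℚ n (λ m → Spowℚ p n m * powℚ x m) ∎
  where
  reorder : ∀ f a i s → f * ((a * i) * s) ≡ (a * i) * (f * s)
  reorder = solve-∀ ℚ-ring
  cancel : ∀ a i f s → (a * i) * (f * s) ≡ (f * i) * (s * a)
  cancel = solve-∀ ℚ-ring

-- The weights 2^-(k+1)

Csum : ℕ → ℕ → ℕ
Csum L j = sumℕ j (L C_)

Csum-double : ∀ L j → Csum L j *ℕ 2 ≡ L C j +ℕ Csum (suc L) j
Csum-double L zero    = refl
Csum-double L (suc j) = begin
  (Csum L j +ℕ c) *ℕ 2                         ≡⟨ ℕP.*-distribʳ-+ 2 (Csum L j) c ⟩
  Csum L j *ℕ 2 +ℕ c *ℕ 2                      ≡⟨ cong (_+ℕ c *ℕ 2) (Csum-double L j) ⟩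
  (L C j +ℕ Csum (suc L) j) +ℕ c *ℕ 2          ≡⟨ regroup (L C j) (Csum (suc L) j) c ⟩
  c +ℕ (Csum (suc L) j +ℕ (L C j +ℕ c))        ≡⟨ cong (λ x → c +ℕ (Csum (suc L) j +ℕ x)) (sym ([n+1]C[k+1]≡nCk+nC[k+1] L j)) ⟩
  c +ℕ Csum (suc L) (suc j)                    ∎
  where
  c = L C suc j
  regroup : ∀ a s b → (a +ℕ s) +ℕ b *ℕ 2 ≡ b +ℕ (s +ℕ (a +ℕ b))
  regroup = NS.solve-∀

Csum[1]≡2 : ∀ j → Csum 1 (suc j) ≡ 2
Csum[1]≡2 zero    = refl
Csum[1]≡2 (suc j) = cong (_+ℕ 0) (Csum[1]≡2 j)

invPow2-suc : ∀ M → invPow2 M ≡ ℕtoℚ 2 * invPow2 (suc M)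
invPow2-suc M = sym (trans (sym (*-assoc (ℕtoℚ 2) (ℤ.+ 1 / 2) (invPow2 M))) (*-identityˡ (invPow2 M)))

2^[M+1]*invPow2[M]≡1 : ∀ M → ℕtoℚ (2 ^ℕ suc M) * invPow2 M ≡ 1ℚ
2^[M+1]*invPow2[M]≡1 zero    = refl
2^[M+1]*invPow2[M]≡1 (suc M) = begin
  ℕtoℚ (2 *ℕ 2 ^ℕ suc M) * invPow2 (suc M)
    ≡⟨ cong (_* invPow2 (suc M)) (ℕtoℚ-* 2 (2 ^ℕ suc M)) ⟩
  (ℕtoℚ 2 * ℕtoℚ (2 ^ℕ suc M)) * (ℤ.+ 1 / 2 * invPow2 M)
    ≡⟨ interchange (ℕtoℚ 2) (ℕtoℚ (2 ^ℕ suc M)) (ℤ.+ 1 / 2) (invPow2 M) ⟩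
  (ℕtoℚ 2 * (ℤ.+ 1 / 2)) * (ℕtoℚ (2 ^ℕ suc M) * invPow2 M)
    ≡⟨ cong (1ℚ *_) (2^[M+1]*invPow2[M]≡1 M) ⟩
  1ℚ * 1ℚ ∎
  where
  interchange : ∀ a b c d → (a * b) * (c * d) ≡ (a * c) * (b * d)
  interchange = solve-∀ ℚ-ring

0≤invPow2 : ∀ M → 0ℚ ≤ invPow2 M
0≤invPow2 M = nonNegative⁻¹ (invPow2 M) {{nonNeg (suc M)}}
  where
  nonNeg : ∀ k → NonNegative (powℚ (ℤ.+ 1 / 2) k)
  nonNeg zero    = _
  nonNeg (suc k) = nonNeg*nonNeg⇒nonNeg (ℤ.+ 1 / 2) (powℚ (ℤ.+ 1 / 2) k) {{nonNeg k}}

sumℚ-Cℚ*invPow2 : ∀ j M → sumℚ M (λ k → Cℚ k j * invPow2 k) ≡ 1ℚ - ℕtoℚ (Csum (suc M) j) * invPow2 M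
sumℚ-Cℚ*invPow2 zero    zero    = refl
sumℚ-Cℚ*invPow2 (suc j) zero    = cong (λ s → 1ℚ - ℕtoℚ s * invPow2 0) (sym (Csum[1]≡2 j))
sumℚ-Cℚ*invPow2 j       (suc M) = begin
  sumℚ M (λ k → Cℚ k j * invPow2 k) + c * w
    ≡⟨ cong (_+ c * w) (trans (sumℚ-Cℚ*invPow2 j M) (cong (λ v → 1ℚ - X * v) (invPow2-suc M))) ⟩
  (1ℚ - X * (ℕtoℚ 2 * w)) + c * w
    ≡⟨ reassoc X (ℕtoℚ 2) w c ⟩
  1ℚ - (X * ℕtoℚ 2) * w + c * w
    ≡⟨ cong (λ x → 1ℚ - x * w + c * w) (trans (sym (ℕtoℚ-* (Csum (suc M) j) 2))
         (trans (cong ℕtoℚ (Csum-double (suc M) j)) (ℕtoℚ-+ (suc M C j) (Csum (suc (suc M)) j)))) ⟩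
  1ℚ - (c + X′) * w + c * w
    ≡⟨ cancel c X′ w ⟩
  1ℚ - X′ * w ∎
  where
  X  = ℕtoℚ (Csum (suc M) j)
  X′ = ℕtoℚ (Csum (suc (suc M)) j)
  c  = Cℚ (suc M) j
  w  = invPow2 (suc M)
  reassoc : ∀ x t w c → (1ℚ - x * (t * w)) + c * w ≡ 1ℚ - (x * t) * w + c * w
  reassoc = solve-∀ ℚ-ring
  cancel : ∀ c x w → 1ℚ - (c + x) * w + c * w ≡ 1ℚ - x * w
  cancel = solve-∀ ℚ-ring

-- (L - i) C(L,i) = (i+1) C(L,i+1) ≤ (n+1) 2^L is what makes the remainder of Σ C(k,j) 2^-(k+1) decay like 1/L.
nCi*[L∸n]≤[n+1]*2^L : ∀ L {n i} → i ≤ℕ n → (L C i) *ℕ (L ∸ n) ≤ℕ suc n *ℕ 2 ^ℕ L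
nCi*[L∸n]≤[n+1]*2^L L {n} {i} i≤n = ℕP.≤-trans (ℕP.*-monoʳ-≤ (L C i) (ℕP.∸-monoʳ-≤ L i≤n))
  (subst (_≤ℕ suc n *ℕ 2 ^ℕ L) (sym (trans (ℕP.*-comm (L C i) (L ∸ i)) ([n∸k]*nCk≡[k+1]*nC[k+1] L i)))
    (ℕP.*-mono-≤ (s≤s i≤n) (nCk≤2^n L (suc i))))

Csum*[L∸n]≤[n+1]²*2^L : ∀ L {n j} → j ≤ℕ n → Csum L j *ℕ (L ∸ n) ≤ℕ suc n *ℕ (suc n *ℕ 2 ^ℕ L)
Csum*[L∸n]≤[n+1]²*2^L L {n} {j} j≤n = ℕP.≤-trans (bound j j≤n) (ℕP.*-monoˡ-≤ (suc n *ℕ 2 ^ℕ L) (s≤s j≤n))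
  where
  bound : ∀ j → j ≤ℕ n → Csum L j *ℕ (L ∸ n) ≤ℕ suc j *ℕ (suc n *ℕ 2 ^ℕ L)
  bound zero    j≤n = subst ((L C 0) *ℕ (L ∸ n) ≤ℕ_) (sym (ℕP.*-identityˡ _)) (nCi*[L∸n]≤[n+1]*2^L L j≤n)
  bound (suc j) j≤n = subst₂ _≤ℕ_ (sym (ℕP.*-distribʳ-+ (L ∸ n) (Csum L j) (L C suc j))) (ℕP.+-comm (suc j *ℕ (suc n *ℕ 2 ^ℕ L)) _)
    (ℕP.+-mono-≤ (bound j (ℕP.≤-trans (ℕP.n≤1+n j) j≤n)) (nCi*[L∸n]≤[n+1]*2^L L j≤n))

-- Convergence of Σₖ B(k) 2^-(k+1)

archimedean : ∀ K ε → 0ℚ < ε → ∃ λ N → ∀ t → N ≤ℕ t → ℕtoℚ K < ℕtoℚ t * ε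
archimedean K (mkℚ ℤ.+[1+ a ] b coprime) _ = suc (K *ℕ suc b) , large
  where
  β = ℤ.+ 1 / suc b
  β≤ε : β ≤ mkℚ ℤ.+[1+ a ] b coprime
  β≤ε = subst (_≤ mkℚ ℤ.+[1+ a ] b coprime) (sym (normalize-coprime (C.1-coprimeTo (suc b))))
    (*≤* (ℤP.*-monoʳ-≤-nonNeg (ℤ.+ suc b) {ℤ.+ 1} {ℤ.+ suc a} (ℤ.+≤+ (s≤s z≤n))))
  K≡K[b+1]β : ℕtoℚ (K *ℕ suc b) * β ≡ ℕtoℚ K
  K≡K[b+1]β = begin
    ℕtoℚ (K *ℕ suc b) * β       ≡⟨ cong (_* β) (ℕtoℚ-* K (suc b)) ⟩
    (ℕtoℚ K * ℕtoℚ (suc b)) * β ≡⟨ *-assoc (ℕtoℚ K) (ℕtoℚ (suc b)) β ⟩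
    ℕtoℚ K * (ℕtoℚ (suc b) * β) ≡⟨ cong (ℕtoℚ K *_) (ℕtoℚ*1/ℕ≡1 (suc b)) ⟩
    ℕtoℚ K * 1ℚ                 ≡⟨ *-identityʳ (ℕtoℚ K) ⟩
    ℕtoℚ K                      ∎
  large : ∀ t → suc (K *ℕ suc b) ≤ℕ t → ℕtoℚ K < ℕtoℚ t * mkℚ ℤ.+[1+ a ] b coprime
  large t N≤t = <-≤-trans (subst (_< ℕtoℚ t * β) K≡K[b+1]β (*-monoˡ-<-pos β {{normalize-pos 1 (suc b)}} (ℕtoℚ-mono-< N≤t)))
                          (*-monoˡ-≤-nonNeg (ℕtoℚ t) {{nonNegative (0≤ℕtoℚ t)}} β≤ε)
archimedean K (mkℚ (ℤ.+ 0) b _)    (*<* (ℤ.+<+ ()))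
archimedean K (mkℚ ℤ.-[1+ a ] b _) (*<* ())

module Series (q n : ℕ) where

  weight : ℕ → ℕ → ℚ
  weight m j = Spowℚ q n m * (Sℚ m j * factℚ j)

  0≤weight : ∀ m j → 0ℚ ≤ weight m j
  0≤weight m j = *-nonNeg (0≤ℕtoℚ (Spow q n m)) (*-nonNeg (0≤ℕtoℚ (S m j)) (0≤ℕtoℚ (j !)))

  Fubini≡sumℚ²-weight : ℕtoℚ (Fubini (suc q) n) ≡ sumℚ² n weight
  Fubini≡sumℚ²-weight = begin
    ℕtoℚ (Fubini (suc q) n)
      ≡⟨ ℕtoℚ-sumℕ n (λ j → Spow (suc q) n j *ℕ j !) ⟩
    sumℚ n (λ j → ℕtoℚ (Spow (suc q) n j *ℕ j !))
      ≡⟨ sumℚ-cong n (λ j _ → trans (ℕtoℚ-* (Spow (suc q) n j) (j !))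
           (trans (cong (_* factℚ j) (Spowℚ-suc q n j)) (*-distribʳ-sumℚ n (factℚ j) _))) ⟩
    sumℚ² n (λ j m → (Spowℚ q n m * Sℚ m j) * factℚ j)
      ≡⟨ sumℚ-swap n n _ ⟩
    sumℚ² n (λ m j → (Spowℚ q n m * Sℚ m j) * factℚ j)
      ≡⟨ sumℚ²-cong n (λ m j _ _ → *-assoc (Spowℚ q n m) (Sℚ m j) (factℚ j)) ⟩
    sumℚ² n weight ∎

  Bell≡sumℚ²-weight : ∀ k → Bell q n (ℕtoℚ k) ≡ sumℚ² n (λ m j → weight m j * Cℚ k j)
  Bell≡sumℚ²-weight k = begin
    Bell q n (ℕtoℚ k)
      ≡⟨ Bell≡sumℚ-Spowℚ q n (ℕtoℚ k) ⟩
    sumℚ n (λ m → Spowℚ q n m * powℚ (ℕtoℚ k) m)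
      ≡⟨ sumℚ-cong n (λ m m≤n → cong (Spowℚ q n m *_) (trans (powℚ≡sumℚ-Stirling k m)
           (sym (sumℚ-extend m≤n (λ j m<j _ → trans (cong (λ s → (ℕtoℚ s * factℚ j) * Cℚ k j) (n<m⇒S[n,m]≡0 m<j))
             (trans (cong (_* Cℚ k j) (*-zeroˡ (factℚ j))) (*-zeroˡ (Cℚ k j)))))))) ⟩
    sumℚ n (λ m → Spowℚ q n m * sumℚ n (λ j → (Sℚ m j * factℚ j) * Cℚ k j))
      ≡⟨ sumℚ-cong n (λ m _ → trans (*-distribˡ-sumℚ n (Spowℚ q n m) _)
           (sumℚ-cong n (λ j _ → sym (*-assoc (Spowℚ q n m) (Sℚ m j * factℚ j) (Cℚ k j))))) ⟩
    sumℚ² n (λ m j → weight m j * Cℚ k j) ∎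

  tail : ℕ → ℕ → ℚ
  tail M j = ℕtoℚ (Csum (suc M) j) * invPow2 M

  remainder : ℕ → ℚ
  remainder M = sumℚ² n (λ m j → weight m j * tail M j)

  partial≡Fubini-remainder : ∀ M →
    partial (λ k → Bell q n (ℕtoℚ k) * invPow2 k) M ≡ ℕtoℚ (Fubini (suc q) n) - remainder M
  partial≡Fubini-remainder M = begin
    sumℚ M (λ k → Bell q n (ℕtoℚ k) * invPow2 k)
      ≡⟨ sumℚ-cong M (λ k _ → trans (cong (_* invPow2 k) (Bell≡sumℚ²-weight k)) (*-distribʳ-sumℚ² n (invPow2 k) _)) ⟩
    sumℚ M (λ k → sumℚ² n (λ m j → (weight m j * Cℚ k j) * invPow2 k))
      ≡⟨ trans (sumℚ-swap M n _) (sumℚ-cong n (λ m _ → sumℚ-swap M n _)) ⟩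
    sumℚ² n (λ m j → sumℚ M (λ k → (weight m j * Cℚ k j) * invPow2 k))
      ≡⟨ sumℚ²-cong n (λ m j _ _ → trans (sumℚ-cong M (λ k _ → *-assoc (weight m j) (Cℚ k j) (invPow2 k)))
           (trans (sym (*-distribˡ-sumℚ M (weight m j) _)) (cong (weight m j *_) (sumℚ-Cℚ*invPow2 j M)))) ⟩
    sumℚ² n (λ m j → weight m j * (1ℚ - tail M j))
      ≡⟨ sumℚ²-cong n (λ m j _ _ → *-distribˡ-minus (weight m j) (tail M j)) ⟩
    sumℚ² n (λ m j → weight m j - weight m j * tail M j)
      ≡⟨ trans (sumℚ-cong n (λ m _ → sumℚ-distrib-minus n (weight m) _)) (sumℚ-distrib-minus n _ _) ⟩
    sumℚ² n weight - remainder M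
      ≡⟨ cong (_- remainder M) (sym Fubini≡sumℚ²-weight) ⟩
    ℕtoℚ (Fubini (suc q) n) - remainder M ∎
    where
    *-distribˡ-minus : ∀ a r → a * (1ℚ - r) ≡ a - a * r
    *-distribˡ-minus = solve-∀ ℚ-ring

  0≤remainder : ∀ M → 0ℚ ≤ remainder M
  0≤remainder M = sumℚ-nonNeg n (λ m _ → sumℚ-nonNeg n (λ j _ →
    *-nonNeg (0≤weight m j) (*-nonNeg (0≤ℕtoℚ (Csum (suc M) j)) (0≤invPow2 M))))

  bound : ℕ
  bound = Fubini (suc q) n *ℕ (suc n *ℕ suc n)

  tail*[M+1∸n]≤[n+1]² : ∀ M {j} → j ≤ℕ n → tail M j * ℕtoℚ (suc M ∸ n) ≤ ℕtoℚ (suc n *ℕ suc n)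
  tail*[M+1∸n]≤[n+1]² M {j} j≤n = subst₂ _≤_ (sym lhs) rhs
    (*-monoʳ-≤-nonNeg (invPow2 M) {{nonNegative (0≤invPow2 M)}} (ℕtoℚ-mono-≤ (Csum*[L∸n]≤[n+1]²*2^L (suc M) j≤n)))
    where
    lhs : tail M j * ℕtoℚ (suc M ∸ n) ≡ ℕtoℚ (Csum (suc M) j *ℕ (suc M ∸ n)) * invPow2 M
    lhs = trans (swap (ℕtoℚ (Csum (suc M) j)) (invPow2 M) (ℕtoℚ (suc M ∸ n)))
                (cong (_* invPow2 M) (sym (ℕtoℚ-* (Csum (suc M) j) (suc M ∸ n))))
      where
      swap : ∀ a b c → (a * b) * c ≡ (a * c) * b
      swap = solve-∀ ℚ-ring
    rhs : ℕtoℚ (suc n *ℕ (suc n *ℕ 2 ^ℕ suc M)) * invPow2 M ≡ ℕtoℚ (suc n *ℕ suc n)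
    rhs = begin
      ℕtoℚ (suc n *ℕ (suc n *ℕ 2 ^ℕ suc M)) * invPow2 M
        ≡⟨ cong (_* invPow2 M) (trans (cong ℕtoℚ (sym (ℕP.*-assoc (suc n) (suc n) (2 ^ℕ suc M))))
             (ℕtoℚ-* (suc n *ℕ suc n) (2 ^ℕ suc M))) ⟩
      (ℕtoℚ (suc n *ℕ suc n) * ℕtoℚ (2 ^ℕ suc M)) * invPow2 M
        ≡⟨ *-assoc (ℕtoℚ (suc n *ℕ suc n)) _ _ ⟩
      ℕtoℚ (suc n *ℕ suc n) * (ℕtoℚ (2 ^ℕ suc M) * invPow2 M)
        ≡⟨ trans (cong (ℕtoℚ (suc n *ℕ suc n) *_) (2^[M+1]*invPow2[M]≡1 M)) (*-identityʳ _) ⟩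
      ℕtoℚ (suc n *ℕ suc n) ∎

  remainder*[M+1∸n]≤bound : ∀ M → remainder M * ℕtoℚ (suc M ∸ n) ≤ ℕtoℚ bound
  remainder*[M+1∸n]≤bound M = subst₂ _≤_ (sym distribute) collect
    (sumℚ-mono-≤ n (λ m _ → sumℚ-mono-≤ n (λ j j≤n →
      *-monoˡ-≤-nonNeg (weight m j) {{nonNegative (0≤weight m j)}} (tail*[M+1∸n]≤[n+1]² M j≤n))))
    where
    t = ℕtoℚ (suc M ∸ n)
    distribute : remainder M * t ≡ sumℚ² n (λ m j → weight m j * (tail M j * t))
    distribute = trans (*-distribʳ-sumℚ² n t _) (sumℚ²-cong n (λ m j _ _ → *-assoc (weight m j) (tail M j) t))
    collect : sumℚ² n (λ m j → weight m j * ℕtoℚ (suc n *ℕ suc n)) ≡ ℕtoℚ bound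
    collect = trans (sym (*-distribʳ-sumℚ² n _ weight))
      (trans (cong (_* ℕtoℚ (suc n *ℕ suc n)) (sym Fubini≡sumℚ²-weight)) (sym (ℕtoℚ-* (Fubini (suc q) n) _)))

  ∣partial-Fubini∣≡remainder : ∀ M →
    ∣ partial (λ k → Bell q n (ℕtoℚ k) * invPow2 k) M - ℕtoℚ (Fubini (suc q) n) ∣ ≡ remainder M
  ∣partial-Fubini∣≡remainder M = begin
    ∣ partial (λ k → Bell q n (ℕtoℚ k) * invPow2 k) M - F ∣ ≡⟨ cong (λ x → ∣ x - F ∣) (partial≡Fubini-remainder M) ⟩
    ∣ (F - remainder M) - F ∣                              ≡⟨ cong ∣_∣ (cancel F (remainder M)) ⟩
    ∣ - remainder M ∣                                      ≡⟨ ∣-p∣≡∣p∣ (remainder M) ⟩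
    ∣ remainder M ∣                                        ≡⟨ 0≤p⇒∣p∣≡p (0≤remainder M) ⟩
    remainder M                                            ∎
    where
    F = ℕtoℚ (Fubini (suc q) n)
    cancel : ∀ f r → (f - r) - f ≡ - r
    cancel = solve-∀ ℚ-ring

  remainder-converges : ∀ ε → 0ℚ < ε → ∃ λ N → ∀ M → N ≤ℕ M → remainder M < ε
  remainder-converges ε 0<ε = N +ℕ n , small
    where
    open Σ (archimedean bound ε 0<ε) renaming (proj₁ to N; proj₂ to large)
    small : ∀ M → N +ℕ n ≤ℕ M → remainder M < ε
    small M N+n≤M = *-cancelʳ-<-nonNeg (ℕtoℚ t) {{nonNegative (0≤ℕtoℚ t)}}
      (subst (remainder M * ℕtoℚ t <_) (*-comm (ℕtoℚ t) ε)
        (≤-<-trans (remainder*[M+1∸n]≤bound M) (large t N≤t)))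
      where
      t = suc M ∸ n
      N≤t : N ≤ℕ t
      N≤t = ℕP.≤-trans (ℕP.m+n≤o⇒m≤o∸n N N+n≤M) (ℕP.∸-monoˡ-≤ n (ℕP.n≤1+n M))

proposition7 : (p : ℕ) → 1 ≤ℕ p → (n : ℕ) →
    (ε : ℚ) → 0ℚ < ε → ∃ λ (N : ℕ) → (M : ℕ) → N ≤ℕ M →
    ∣ partial (λ k → Bell (p ∸ 1) n (ℕtoℚ k) * invPow2 k) M - ℕtoℚ (Fubini p n) ∣ < ε
proposition7 (suc q) _ n ε 0<ε = N , λ M N≤M → subst (_< ε) (sym (∣partial-Fubini∣≡remainder M)) (small M N≤M)
  where
  open Series q n
  open Σ (remainder-converges ε 0<ε) renaming (proj₁ to N; proj₂ to small)
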